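{- Let $M$ be a matroid on a finite set $E$ and let $M'$ be a relaxation of $M$. Then every degenerate quadrangle of $M'$ is a degenerate quadrangle of $M$.
   Context: If $X$ is a circuit-hyperplane (a set that is both a circuit and a hyperplane) of $M$ with set of bases $\mathcal{B}$, then $\mathcal{B}\cup\{X\}$ is the set of bases of a matroid $M'$, called the relaxation of $M$ by $X$; a relaxation of $M$ is a matroid arising this way. Four bases $B_1,B_2,B_3,B_4$ of a matroid form a degenerate quadrangle if there are $S\subseteq E$ and pairwise different $i,j,k,l\notin S$ with $(B_1,B_2,B_3,B_4)=(S\cup\{i,k\},S\cup\{j,l\},S\cup\{i,l\},S\cup\{j,k\})$ and at most one of $S\cup\{i,j\}$, $S\cup\{k,l\}$ is a basis of that matroid. -}

module Defs where

open import Level using (Level; suc; _⊔_)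
open import Data.Nat using (ℕ)
open import Data.Fin using (Fin)
open import Data.Fin.Subset using (Subset; _∈_; _∉_; _⊆_; _⊂_; _∪_; _-_; ⁅_⁆)
open import Data.Product using (Σ; ∃; _×_; _,_)
open import Data.Sum using (_⊎_)
open import Relation.Nullary using (¬_)
open import Relation.Binary.PropositionalEquality using (_≡_; _≢_)

record Matroid (n : ℕ) : Set₁ where
  field
    IsBasis  : Subset n → Set
    nonempty : ∃ λ B → IsBasis B
    exchange : ∀ B₁ B₂ → IsBasis B₁ → IsBasis B₂ →
               ∀ x → x ∈ B₁ → x ∉ B₂ →
               ∃ λ y → y ∈ B₂ × y ∉ B₁ × IsBasis ((B₁ - x) ∪ ⁅ y ⁆)

open Matroid public

module _ {n : ℕ} (M : Matroid n) where

  Independent : Subset n → Set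
  Independent X = ∃ λ B → IsBasis M B × X ⊆ B

  Spanning : Subset n → Set
  Spanning X = ∃ λ B → IsBasis M B × B ⊆ X

  IsCircuit : Subset n → Set
  IsCircuit X = ¬ Independent X × (∀ Y → Y ⊂ X → Independent Y)

  IsHyperplane : Subset n → Set
  IsHyperplane X = ¬ Spanning X × (∀ Y → X ⊂ Y → Spanning Y)

  IsCircuitHyperplane : Subset n → Set
  IsCircuitHyperplane X = IsCircuit X × IsHyperplane X

  DegenerateQuadrangle : Subset n → Subset n → Subset n → Subset n → Set
  DegenerateQuadrangle B₁ B₂ B₃ B₄ =
    IsBasis M B₁ × IsBasis M B₂ × IsBasis M B₃ × IsBasis M B₄ ×
    Σ (Subset n) λ S → Σ (Fin n) λ i → Σ (Fin n) λ j → Σ (Fin n) λ k → Σ (Fin n) λ l →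
      (i ≢ j × i ≢ k × i ≢ l × j ≢ k × j ≢ l × k ≢ l) ×
      (i ∉ S × j ∉ S × k ∉ S × l ∉ S) ×
      (B₁ ≡ S ∪ (⁅ i ⁆ ∪ ⁅ k ⁆)) × (B₂ ≡ S ∪ (⁅ j ⁆ ∪ ⁅ l ⁆)) ×
      (B₃ ≡ S ∪ (⁅ i ⁆ ∪ ⁅ l ⁆)) × (B₄ ≡ S ∪ (⁅ j ⁆ ∪ ⁅ k ⁆)) ×
      ¬ (IsBasis M (S ∪ (⁅ i ⁆ ∪ ⁅ j ⁆)) × IsBasis M (S ∪ (⁅ k ⁆ ∪ ⁅ l ⁆)))

IsRelaxationBy : ∀ {n} → Matroid n → Subset n → Matroid n → Set
IsRelaxationBy M X M' =
  IsCircuitHyperplane M X × (∀ B → IsBasis M' B → IsBasis M B ⊎ B ≡ X)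
                          × (∀ B → IsBasis M B ⊎ B ≡ X → IsBasis M' B)

IsRelaxation : ∀ {n} → Matroid n → Matroid n → Set
IsRelaxation M M' = ∃ λ X → IsRelaxationBy M X M'

{-# OPTIONS --safe #-}
-- The only basis of M' that is not a basis of M is the circuit-hyperplane X, which is
-- not a basis of M. Were B₁ = S ∪ {i, k} equal to X, then B₃ = S ∪ {i, l} and
-- B₄ = S ∪ {j, k} would be bases of M; exchanging l out of B₃ against B₄ yields
-- S ∪ {i, j} or X, so S ∪ {i, j} is a basis of M, and exchanging j out of B₄ against B₃
-- likewise makes S ∪ {k, l} a basis. Both would then be bases of M', contradicting
-- degeneracy. The other Bᵣ reduce to this case by relabelling i, j, k, l.
module Submission where

open import Defs
open import Data.Nat using (ℕ)
open import Data.Fin using (Fin)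
open import Data.Fin.Subset
  using (Subset; inside; outside; _∈_; _∉_; _⊆_; _∪_; _─_; _-_; ⁅_⁆)
open import Data.Fin.Subset.Properties
  using (x∈p∪q⁺; x∈p∪q⁻; x∈⁅x⁆; x∈⁅y⁆⇒x≡y; ∪-comm; ⊆-antisym; p─q⊆p; x∈p∧x≢y⇒x∈p-y)
open import Data.Vec.Base using (_∷_; here; there)
open import Data.Product using (_×_; _,_; proj₁; proj₂; map; map₁; map₂)
open import Data.Sum using (_⊎_; inj₁; inj₂; fromInj₁)
open import Function using (_∘_)
open import Data.Empty using (⊥-elim)
open import Relation.Nullary using (¬_)
open import Relation.Binary.PropositionalEquality
  using (_≡_; _≢_; refl; cong; subst; ≢-sym)

private variable
  n : ℕ
  S p q : Subset n
  a b c x : Fin n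

_∪⁅_,_⁆ : Subset n → Fin n → Fin n → Subset n
S ∪⁅ a , b ⁆ = S ∪ (⁅ a ⁆ ∪ ⁅ b ⁆)

x∈p─q⇒x∉q : x ∈ p ─ q → x ∉ q
x∈p─q⇒x∉q {p = inside ∷ p} {q = outside ∷ q} here ()
x∈p─q⇒x∉q {p = _ ∷ p} {q = _ ∷ q} (there x∈p─q) (there x∈q) = x∈p─q⇒x∉q x∈p─q x∈q

x∈p∧x∉q⇒p≢q : x ∈ p → x ∉ q → p ≢ q
x∈p∧x∉q⇒p≢q x∈p x∉p refl = x∉p x∈p

∈-∪⁅,⁆⁻ : x ∈ S ∪⁅ a , b ⁆ → x ∈ S ⊎ x ≡ a ⊎ x ≡ b
∈-∪⁅,⁆⁻ {S = S} {a = a} {b = b} x∈ with x∈p∪q⁻ S _ x∈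
... | inj₁ x∈S = inj₁ x∈S
... | inj₂ x∈ab with x∈p∪q⁻ ⁅ a ⁆ ⁅ b ⁆ x∈ab
...   | inj₁ x∈a = inj₂ (inj₁ (x∈⁅y⁆⇒x≡y a x∈a))
...   | inj₂ x∈b = inj₂ (inj₂ (x∈⁅y⁆⇒x≡y b x∈b))

∈-∪⁅,⁆⁺ : x ∈ S → x ∈ S ∪⁅ a , b ⁆
∈-∪⁅,⁆⁺ x∈S = x∈p∪q⁺ (inj₁ x∈S)

a∈∪⁅a,b⁆ : a ∈ S ∪⁅ a , b ⁆
a∈∪⁅a,b⁆ {a = a} = x∈p∪q⁺ (inj₂ (x∈p∪q⁺ (inj₁ (x∈⁅x⁆ a))))

b∈∪⁅a,b⁆ : b ∈ S ∪⁅ a , b ⁆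
b∈∪⁅a,b⁆ {b = b} = x∈p∪q⁺ (inj₂ (x∈p∪q⁺ (inj₂ (x∈⁅x⁆ b))))

∉-∪⁅,⁆⁺ : x ∉ S → x ≢ a → x ≢ b → x ∉ S ∪⁅ a , b ⁆
∉-∪⁅,⁆⁺ x∉S x≢a x≢b x∈ with ∈-∪⁅,⁆⁻ x∈
... | inj₁ x∈S        = x∉S x∈S
... | inj₂ (inj₁ x≡a) = x≢a x≡a
... | inj₂ (inj₂ x≡b) = x≢b x≡b

∉-∪⁅,⁆⁻ : x ∉ S ∪⁅ a , b ⁆ → x ∉ S × x ≢ a × x ≢ b
∉-∪⁅,⁆⁻ x∉ = (λ x∈S → x∉ (∈-∪⁅,⁆⁺ x∈S))
           , (λ { refl → x∉ a∈∪⁅a,b⁆ })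
           , (λ { refl → x∉ b∈∪⁅a,b⁆ })

∪⁅,⁆-comm : S ∪⁅ a , b ⁆ ≡ S ∪⁅ b , a ⁆
∪⁅,⁆-comm {S = S} {a = a} {b = b} = cong (S ∪_) (∪-comm ⁅ a ⁆ ⁅ b ⁆)

∪⁅,⁆-replace : b ∉ S → b ≢ a → ∀ c → (S ∪⁅ a , b ⁆ - b) ∪ ⁅ c ⁆ ≡ S ∪⁅ a , c ⁆
∪⁅,⁆-replace {b = b} {S = S} {a = a} b∉S b≢a c = ⊆-antisym into onto
  where
  into : (S ∪⁅ a , b ⁆ - b) ∪ ⁅ c ⁆ ⊆ S ∪⁅ a , c ⁆
  into x∈ with x∈p∪q⁻ (S ∪⁅ a , b ⁆ - b) ⁅ c ⁆ x∈
  ... | inj₂ x∈c rewrite x∈⁅y⁆⇒x≡y c x∈c = b∈∪⁅a,b⁆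
  ... | inj₁ x∈S∪ab-b with ∈-∪⁅,⁆⁻ (p─q⊆p _ _ x∈S∪ab-b)
  ...   | inj₁ x∈S         = ∈-∪⁅,⁆⁺ x∈S
  ...   | inj₂ (inj₁ refl) = a∈∪⁅a,b⁆
  ...   | inj₂ (inj₂ refl) = ⊥-elim (x∈p─q⇒x∉q x∈S∪ab-b (x∈⁅x⁆ b))
  onto : S ∪⁅ a , c ⁆ ⊆ (S ∪⁅ a , b ⁆ - b) ∪ ⁅ c ⁆
  onto x∈ with ∈-∪⁅,⁆⁻ x∈
  ... | inj₁ x∈S         = x∈p∪q⁺ (inj₁ (x∈p∧x≢y⇒x∈p-y (∈-∪⁅,⁆⁺ x∈S) λ { refl → b∉S x∈S }))
  ... | inj₂ (inj₁ refl) = x∈p∪q⁺ (inj₁ (x∈p∧x≢y⇒x∈p-y a∈∪⁅a,b⁆ (≢-sym b≢a)))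
  ... | inj₂ (inj₂ refl) = x∈p∪q⁺ (inj₂ (x∈⁅x⁆ c))

module _ (M : Matroid n) where

  basis⇒independent : ∀ {B} → IsBasis M B → Independent M B
  basis⇒independent {B} B-basis = B , B-basis , λ x∈B → x∈B

  basis-∪⁅,⁆-comm : ∀ {S a b} → IsBasis M (S ∪⁅ a , b ⁆) → IsBasis M (S ∪⁅ b , a ⁆)
  basis-∪⁅,⁆-comm = subst (IsBasis M) ∪⁅,⁆-comm

  pair-exchange : ∀ {S a b c d} → d ∉ S → d ≢ a → d ≢ b → d ≢ c →
                  IsBasis M (S ∪⁅ a , d ⁆) → IsBasis M (S ∪⁅ b , c ⁆) →
                  IsBasis M (S ∪⁅ a , b ⁆) ⊎ IsBasis M (S ∪⁅ a , c ⁆)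
  pair-exchange {b = b} {c = c} {d = d} d∉S d≢a d≢b d≢c ad-basis bc-basis
    with exchange M _ _ ad-basis bc-basis d b∈∪⁅a,b⁆ (∉-∪⁅,⁆⁺ d∉S d≢b d≢c)
  ... | y , y∈bc , y∉ad , basis with ∈-∪⁅,⁆⁻ y∈bc
  ...   | inj₁ y∈S         = ⊥-elim (y∉ad (∈-∪⁅,⁆⁺ y∈S))
  ...   | inj₂ (inj₁ refl) = inj₁ (subst (IsBasis M) (∪⁅,⁆-replace d∉S d≢a b) basis)
  ...   | inj₂ (inj₂ refl) = inj₂ (subst (IsBasis M) (∪⁅,⁆-replace d∉S d≢a c) basis)

  ij-kl-bases : ∀ {S i j k l} → j ∉ S ∪⁅ i , k ⁆ → l ∉ S ∪⁅ i , k ⁆ → j ≢ l →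
                ¬ IsBasis M (S ∪⁅ i , k ⁆) →
                IsBasis M (S ∪⁅ i , l ⁆) → IsBasis M (S ∪⁅ j , k ⁆) →
                IsBasis M (S ∪⁅ i , j ⁆) × IsBasis M (S ∪⁅ k , l ⁆)
  ij-kl-bases {S} {i} {j} {k} {l} j∉ik l∉ik j≢l ¬ik il jk = ij , kl
    where
    ij : IsBasis M (S ∪⁅ i , j ⁆)
    ij = let l∉S , l≢i , l≢k = ∉-∪⁅,⁆⁻ l∉ik in
      fromInj₁ (⊥-elim ∘ ¬ik) (pair-exchange l∉S l≢i (≢-sym j≢l) l≢k il jk)
    kl : IsBasis M (S ∪⁅ k , l ⁆)
    kl = let j∉S , j≢i , j≢k = ∉-∪⁅,⁆⁻ j∉ik in
      fromInj₁ (⊥-elim ∘ ¬ik ∘ basis-∪⁅,⁆-comm)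
               (pair-exchange j∉S j≢k j≢l j≢i (basis-∪⁅,⁆-comm jk) (basis-∪⁅,⁆-comm il))

module Relaxation {M M' : Matroid n} {X : Subset n} (relaxation : IsRelaxationBy M X M') where

  private
    X-circuit-hyperplane : IsCircuitHyperplane M X
    X-circuit-hyperplane = proj₁ relaxation

    relaxed-basis⇒basis-or-X : ∀ B → IsBasis M' B → IsBasis M B ⊎ B ≡ X
    relaxed-basis⇒basis-or-X = proj₁ (proj₂ relaxation)

    basis-or-X⇒relaxed-basis : ∀ B → IsBasis M B ⊎ B ≡ X → IsBasis M' B
    basis-or-X⇒relaxed-basis = proj₂ (proj₂ relaxation)

  X-not-basis : ¬ IsBasis M X
  X-not-basis = proj₁ (proj₁ X-circuit-hyperplane) ∘ basis⇒independent M

  basis⇒relaxed-basis : ∀ {B} → IsBasis M B → IsBasis M' B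
  basis⇒relaxed-basis B-basis = basis-or-X⇒relaxed-basis _ (inj₁ B-basis)

  relaxed-basis⇒basis : ∀ {B} → IsBasis M' B → B ≢ X → IsBasis M B
  relaxed-basis⇒basis B-basis B≢X with relaxed-basis⇒basis-or-X _ B-basis
  ... | inj₁ basis = basis
  ... | inj₂ B≡X   = ⊥-elim (B≢X B≡X)

  relaxed-ij-kl-bases : ∀ {S i j k l} → S ∪⁅ i , k ⁆ ≡ X →
                        j ∉ S ∪⁅ i , k ⁆ → l ∉ S ∪⁅ i , k ⁆ → j ≢ l →
                        IsBasis M' (S ∪⁅ i , l ⁆) → IsBasis M' (S ∪⁅ j , k ⁆) →
                        IsBasis M (S ∪⁅ i , j ⁆) × IsBasis M (S ∪⁅ k , l ⁆)
  relaxed-ij-kl-bases ik≡X j∉ik l∉ik j≢l il jk =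
    ij-kl-bases M j∉ik l∉ik j≢l (X-not-basis ∘ subst (IsBasis M) ik≡X)
      (relaxed-basis⇒basis il (x∈p∧x∉q⇒p≢q b∈∪⁅a,b⁆ (subst (_ ∉_) ik≡X l∉ik)))
      (relaxed-basis⇒basis jk (x∈p∧x∉q⇒p≢q a∈∪⁅a,b⁆ (subst (_ ∉_) ik≡X j∉ik)))

lemma4p6 : (n : ℕ) (M M' : Matroid n) → IsRelaxation M M' →
    (B₁ B₂ B₃ B₄ : Subset n) →
    DegenerateQuadrangle M' B₁ B₂ B₃ B₄ → DegenerateQuadrangle M B₁ B₂ B₃ B₄
lemma4p6 n M M' (X , relaxation) B₁ B₂ B₃ B₄
  (ik , jl , il , jk , S , i , j , k , l , distinct@(i≢j , i≢k , i≢l , j≢k , j≢l , k≢l) ,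
   fresh@(i∉S , j∉S , k∉S , l∉S) , refl , refl , refl , refl , ¬ij∧kl) =
  basis₁ , basis₂ , basis₃ , basis₄ , S , i , j , k , l , distinct , fresh ,
  refl , refl , refl , refl , ¬ij∧kl-in-M
  where
  open Relaxation {M = M} {M' = M'} {X = X} relaxation

  comm : ∀ {a b} → IsBasis M (S ∪⁅ a , b ⁆) → IsBasis M (S ∪⁅ b , a ⁆)
  comm = basis-∪⁅,⁆-comm M

  ¬ij∧kl-in-M : ¬ (IsBasis M (S ∪⁅ i , j ⁆) × IsBasis M (S ∪⁅ k , l ⁆))
  ¬ij∧kl-in-M (ij , kl) = ¬ij∧kl (basis⇒relaxed-basis ij , basis⇒relaxed-basis kl)

  basis₁ : IsBasis M (S ∪⁅ i , k ⁆)
  basis₁ = relaxed-basis⇒basis ik λ ik≡X → ¬ij∧kl-in-M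
    (relaxed-ij-kl-bases ik≡X
      (∉-∪⁅,⁆⁺ j∉S (≢-sym i≢j) j≢k) (∉-∪⁅,⁆⁺ l∉S (≢-sym i≢l) (≢-sym k≢l)) j≢l il jk)
  basis₂ : IsBasis M (S ∪⁅ j , l ⁆)
  basis₂ = relaxed-basis⇒basis jl λ jl≡X → ¬ij∧kl-in-M (map comm comm
    (relaxed-ij-kl-bases jl≡X
      (∉-∪⁅,⁆⁺ i∉S i≢j i≢l) (∉-∪⁅,⁆⁺ k∉S (≢-sym j≢k) k≢l) i≢k jk il))
  basis₃ : IsBasis M (S ∪⁅ i , l ⁆)
  basis₃ = relaxed-basis⇒basis il λ il≡X → ¬ij∧kl-in-M (map₂ comm
    (relaxed-ij-kl-bases il≡X
      (∉-∪⁅,⁆⁺ j∉S (≢-sym i≢j) j≢l) (∉-∪⁅,⁆⁺ k∉S (≢-sym i≢k) k≢l) j≢k ik jl))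
  basis₄ : IsBasis M (S ∪⁅ j , k ⁆)
  basis₄ = relaxed-basis⇒basis jk λ jk≡X → ¬ij∧kl-in-M (map₁ comm
    (relaxed-ij-kl-bases jk≡X
      (∉-∪⁅,⁆⁺ i∉S i≢j i≢k) (∉-∪⁅,⁆⁺ l∉S (≢-sym j≢l) (≢-sym k≢l)) i≢l jl ik))
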